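{- Let $\mathcal{A}$ be an approximable quasi-ats. Then applicative bisimulation coincides with the logical preorder: ${\lesssim^B}={\lesssim^{\mathcal{L}}}$.
   Context: A quasi-ats is $(A,ev)$ with $ev:A\rightharpoonup(A\to A)$; write $a\Downarrow f$ if $ev(a)=f$, $a\Uparrow$ if $ev(a)$ is undefined, and $ab=f(b)$ if $a\Downarrow f$ (and $ab=a$ if $a\Uparrow$). Applicative bisimulation $\lesssim^B$ is the largest relation $R$ such that $aRb$ and $a\Downarrow f$ imply $b\Downarrow g$ and $f(c)\,R\,g(c)$ for all $c\in A$. The logic $\mathcal{L}$ has formulas $\phi::=t\mid\phi\wedge\psi\mid(\phi\to\psi)_\bot$ ($t$ = true), with $a\models t$ always, conjunction as usual, and $a\models(\phi\to\psi)_\bot$ iff $a\Downarrow f$ and for all $b$, $b\models\phi$ implies $f(b)\models\psi$. Let $\lambda\equiv(t\to t)_\bot$, so $a\models\lambda$ iff $a\Downarrow$. Define $a\lesssim^{\mathcal{L}}b$ iff every formula of $\mathcal{L}$ satisfied by $a$ is satisfied by $b$. $\mathcal{A}$ is approximable if whenever $ab_1\cdots b_n\Downarrow$ there are $\phi_1,\dots,\phi_n\in\mathcal{L}$ with $a\models(\phi_1\to\cdots(\phi_n\to\lambda)_\bot\cdots)_\bot$ and $b_i\models\phi_i$ for $1\le i\le n$. -}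

module Defs where

open import Level using (Level; suc; _⊔_)
open import Data.Maybe using (Maybe; just; nothing)
open import Data.Product using (Σ; _×_; _,_; ∃)
open import Data.Unit using (⊤)
open import Data.Nat using (ℕ)
open import Data.Vec using (Vec; []; _∷_)
open import Data.Vec.Relation.Unary.All using (All)
open import Data.Vec.Relation.Binary.Pointwise.Inductive using (Pointwise)
open import Relation.Binary.PropositionalEquality using (_≡_)
open import Function.Bundles using (_⇔_)

-- A quasi-ats: a set A with a partial map ev : A ⇀ (A → A),
-- partiality modelled by Maybe (ev a ≡ nothing means a⇑).
record QuasiATS : Set₁ where
  field
    A  : Set
    ev : A → Maybe (A → A)

module _ (𝒜 : QuasiATS) where
  open QuasiATS 𝒜

  _⇓_ : A → (A → A) → Set
  a ⇓ f = ev a ≡ just f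

  _⇓ : A → Set
  a ⇓ = ∃ λ f → a ⇓ f

  app : A → A → A
  app a b with ev a
  ... | just f  = f b
  ... | nothing = a

  appN : ∀ {n} → A → Vec A n → A
  appN a []       = a
  appN a (b ∷ bs) = appN (app a b) bs

  IsAppSim : (A → A → Set) → Set
  IsAppSim R = ∀ a b → R a b → ∀ f → a ⇓ f →
               Σ (A → A) λ g → (b ⇓ g) × (∀ c → R (f c) (g c))

  -- applicative bisimulation ≲B: the largest applicative simulation,
  -- i.e. the union of all applicative simulations
  _≲B_ : A → A → Set₁
  a ≲B b = Σ (A → A → Set) λ R → IsAppSim R × R a b

  data Formula : Set where
    tt    : Formula
    _∧_   : Formula → Formula → Formula
    [_⇒_]⊥ : Formula → Formula → Formula

  _⊨_ : A → Formula → Set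
  a ⊨ tt          = ⊤
  a ⊨ (φ ∧ ψ)     = (a ⊨ φ) × (a ⊨ ψ)
  a ⊨ [ φ ⇒ ψ ]⊥  = Σ (A → A) λ f → (a ⇓ f) × (∀ b → b ⊨ φ → f b ⊨ ψ)

  λ𝓛 : Formula
  λ𝓛 = [ tt ⇒ tt ]⊥

  arrows : ∀ {n} → Vec Formula n → Formula
  arrows []       = λ𝓛
  arrows (φ ∷ φs) = [ φ ⇒ arrows φs ]⊥

  _≲L_ : A → A → Set
  a ≲L b = ∀ φ → a ⊨ φ → b ⊨ φ

  Approximable : Set
  Approximable = ∀ n (a : A) (bs : Vec A n) → appN a bs ⇓ →
    Σ (Vec Formula n) λ φs → (a ⊨ arrows φs) × Pointwise _⊨_ bs φs

-- Soundness (≲B ⊆ ≲L) holds in every quasi-ats: by induction on formulas,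
-- every applicative simulation preserves satisfaction, since the clause for
-- (φ → ψ)⊥ asks exactly for the convergence and pointwise behaviour that a
-- simulation transfers.
--
-- Completeness (≲L ⊆ ≲B) goes through the convergence-testing preorder
--   a ≲⇓ b  ⇔  for every argument list bs, a bs ⇓ implies b bs ⇓,
-- which is an applicative simulation in every quasi-ats.  If a ≲L b and
-- a bs ⇓, approximability yields formulas φs with a ⊨ (φs → λ)⊥ and bs ⊨ φs;
-- then b ⊨ (φs → λ)⊥, and such a formula forces b bs ⇓.  Hence ≲L ⊆ ≲⇓,
-- and ≲⇓ witnesses a ≲B b.
module Submission where

open import Defs
-- The unary predicate a ⇓ clashes in parsing with the binary a ⇓ f.
open Defs using () renaming (_⇓ to Converges)
open import Data.Nat using (suc)
open import Data.Product using (_×_; _,_)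
open import Data.Maybe using (just)
open import Data.Vec using (Vec; []; _∷_)
open import Data.Vec.Relation.Binary.Pointwise.Inductive using (Pointwise; []; _∷_)
open import Relation.Binary.PropositionalEquality using (_≡_; refl; cong; subst; sym)

module Theory (𝒜 : QuasiATS) where
  open QuasiATS 𝒜

  app-⇓ : ∀ {a f} b → _⇓_ 𝒜 a f → app 𝒜 a b ≡ f b
  app-⇓ {a} b eq with ev a
  app-⇓ b refl | just f = refl

  appN-⇓ : ∀ {n a f} c (bs : Vec A n) → _⇓_ 𝒜 a f → appN 𝒜 a (c ∷ bs) ≡ appN 𝒜 (f c) bs
  appN-⇓ c bs eq = cong (λ x → appN 𝒜 x bs) (app-⇓ c eq)

  simulation-preserves-⊨ : (R : A → A → Set) → IsAppSim 𝒜 R →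
                           ∀ φ {a b} → R a b → _⊨_ 𝒜 a φ → _⊨_ 𝒜 b φ
  simulation-preserves-⊨ R sim tt        r p       = p
  simulation-preserves-⊨ R sim (φ ∧ ψ)   r (p , q) =
    simulation-preserves-⊨ R sim φ r p , simulation-preserves-⊨ R sim ψ r q
  simulation-preserves-⊨ R sim [ φ ⇒ ψ ]⊥ {a} {b} r (f , a⇓f , f⊨) with sim a b r f a⇓f
  ... | g , b⇓g , fRg = g , b⇓g , λ c c⊨φ → simulation-preserves-⊨ R sim ψ (fRg c) (f⊨ c c⊨φ)

  ≲B⇒≲L : ∀ {a b} → _≲B_ 𝒜 a b → _≲L_ 𝒜 a b
  ≲B⇒≲L (R , sim , r) φ = simulation-preserves-⊨ R sim φ r

  arrows-converge : ∀ {n} {a} {bs : Vec A n} {φs : Vec (Formula 𝒜) n} →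
                    _⊨_ 𝒜 a (arrows 𝒜 φs) → Pointwise (_⊨_ 𝒜) bs φs → Converges 𝒜 (appN 𝒜 a bs)
  arrows-converge (f , a⇓f , _) [] = f , a⇓f
  arrows-converge {a = a} {b ∷ bs} {φ ∷ φs} (f , a⇓f , f⊨) (b⊨φ ∷ bs⊨φs) =
    arrows-converge (subst (λ x → _⊨_ 𝒜 x (arrows 𝒜 φs)) (sym (app-⇓ b a⇓f)) (f⊨ b b⊨φ)) bs⊨φs

  _≲⇓_ : A → A → Set
  a ≲⇓ b = ∀ n (bs : Vec A n) → Converges 𝒜 (appN 𝒜 a bs) → Converges 𝒜 (appN 𝒜 b bs)

  -- ≲⇓ is an applicative simulation: convergence of a gives convergence of b
  -- (empty argument list), and testing f c on bs is testing a on c ∷ bs.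
  ≲⇓-isAppSim : IsAppSim 𝒜 _≲⇓_
  ≲⇓-isAppSim a b a≲b f a⇓f with a≲b 0 [] (f , a⇓f)
  ... | g , b⇓g = g , b⇓g , λ c n bs fc⇓ →
    subst (Converges 𝒜) (appN-⇓ c bs b⇓g)
      (a≲b (suc n) (c ∷ bs) (subst (Converges 𝒜) (sym (appN-⇓ c bs a⇓f)) fc⇓))

  ≲L⇒≲⇓ : Approximable 𝒜 → ∀ {a b} → _≲L_ 𝒜 a b → a ≲⇓ b
  ≲L⇒≲⇓ approx {a} a≲b n bs a-bs⇓ with approx n a bs a-bs⇓
  ... | φs , a⊨ , bs⊨φs = arrows-converge (a≲b (arrows 𝒜 φs) a⊨) bs⊨φs

  ≲L⇒≲B : Approximable 𝒜 → ∀ {a b} → _≲L_ 𝒜 a b → _≲B_ 𝒜 a b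
  ≲L⇒≲B approx a≲b = _≲⇓_ , ≲⇓-isAppSim , ≲L⇒≲⇓ approx a≲b

mainTheorem17 : (𝒜 : QuasiATS) → Approximable 𝒜 →
    ∀ a b → (_≲B_ 𝒜 a b → _≲L_ 𝒜 a b) × (_≲L_ 𝒜 a b → _≲B_ 𝒜 a b)
mainTheorem17 𝒜 approx a b = ≲B⇒≲L , ≲L⇒≲B approx
  where open Theory 𝒜
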